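{- For every $n\ge1$ the poset $\mathcal{L}_n$ is a lattice. Moreover, for every $n>1$ and any $\vec s,\vec t\in\{ -1,1\}^n$ with $s_n\le t_n$, \[ \vec s\vee\vec t=\begin{cases}\bigl(\pi(\vec s)\vee\pi(\vec t),\,\epsilon\bigr) & \text{if } s_n=t_n=\epsilon\in\{\pm1\},\\ \bigl(\pi(m_n^+(\vec s))\vee\pi(\vec t),\,1\bigr) & \text{if } s_n=-1,\ t_n=1,\end{cases} \] \[ \vec s\wedge\vec t=\begin{cases}\bigl(\pi(\vec s)\wedge\pi(\vec t),\,\epsilon\bigr) & \text{if } s_n=t_n=\epsilon\in\{\pm1\},\\ \bigl(\pi(\vec s)\wedge\pi(m_n^-(\vec t)),\,-1\bigr) & \text{if } s_n=-1,\ t_n=1,\end{cases} \] where the joins and meets on the right-hand side are taken in $\mathcal{L}_{n-1}$.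
   Context: Let $[n]=\{1,\dots,n\}$, $[k,n]=\{k,\dots,n\}$. $\mathcal{L}_n$ is the set of subsets of $[n]$ with $I\le_n J$ iff $\#(I\cap[k,n])\le\#(J\cap[k,n])$ for all $k$. Identify a subset $S\subseteq[n]$ with $\vec s\in\{ -1,1\}^n$, $s_i=1$ iff $i\in S$; then $\vec s\le_n\vec t$ iff $\sum_{i\ge k}s_i\le\sum_{i\ge k}t_i$ for all $k$. For $\vec u\in\{ -1,1\}^{n-1}$ and $\epsilon=\pm1$, $(\vec u,\epsilon)\in\{ -1,1\}^n$ is the vector obtained by appending $\epsilon$. $\pi:\mathcal{L}_n\to\mathcal{L}_{n-1}$, $\pi(s_1,\dots,s_n)=(s_1,\dots,s_{n-1})$ (i.e. $S\mapsto S\setminus\{n\}$). Let $\mathcal{L}_n^{\pm}=\{\vec s: s_n=\pm1\}$. For $\vec s\in\mathcal{L}_n$, $m_n^+(\vec s)$ denotes the minimum element of $\{\vec u\in\mathcal{L}_n^+ : \vec u\ge_n\vec s\}$ and $m_n^-(\vec s)$ denotes the maximum element of $\{\vec u\in\mathcal{L}_n^- : \vec u\le_n\vec s\}$ (these minimum/maximum elements exist). -}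

module Defs where

open import Data.Bool using (Bool; true; false)
open import Data.Nat using (ℕ; suc)
open import Data.Fin using (Fin; toℕ)
open import Data.Integer using (ℤ; +_; -[1+_]; _+_; _≤_)
open import Data.List using (List; drop; foldr)
open import Data.Vec using (Vec; toList; init)
open import Data.Product using (_×_)
open import Relation.Binary.PropositionalEquality using (_≡_)

-- A subset S of [n] is encoded as s ∈ {-1,1}^n, here Vec Bool n with
-- true ↔ +1 (i ∈ S) and false ↔ -1 (i ∉ S). Position i (1-based) is
-- the i-th entry of the vector, so s_n is the last entry.
val : Bool → ℤ
val true  = + 1
val false = -[1+ 0 ]

sumL : List Bool → ℤ
sumL = foldr (λ b z → val b + z) (+ 0)

-- suffixSum k s = Σ_{i ≥ k+1} s_i   (k : Fin n is 0-based, so k+1 ranges over 1..n)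
suffixSum : ∀ {n} → Fin n → Vec Bool n → ℤ
suffixSum k s = sumL (drop (toℕ k) (toList s))

_≤ₙ_ : ∀ {n} → Vec Bool n → Vec Bool n → Set
_≤ₙ_ {n} s t = ∀ (k : Fin n) → suffixSum k s ≤ suffixSum k t

π : ∀ {n} → Vec Bool (suc n) → Vec Bool n
π = init

IsMPlus : ∀ {n} → Vec Bool (suc n) → Vec Bool (suc n) → Set
IsMPlus s w = (Data.Vec.last w ≡ true × s ≤ₙ w)
  × (∀ u → Data.Vec.last u ≡ true → s ≤ₙ u → w ≤ₙ u)

IsMMinus : ∀ {n} → Vec Bool (suc n) → Vec Bool (suc n) → Set
IsMMinus s w = (Data.Vec.last w ≡ false × w ≤ₙ s)
  × (∀ u → Data.Vec.last u ≡ false → u ≤ₙ s → u ≤ₙ w)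

module Submission where

-- Write #ₖ(S) = #(S ∩ [k+1,n]) for the number of +1 entries of
-- s after position k.  Since Σ_{i>k} s_i = 2·#ₖ(S) − (n − k), the order ≤ₙ
-- compares these "suffix counts" pointwise, and a vector is determined by
-- its suffix counts.  The pointwise maximum (minimum) of two suffix-count
-- profiles is again a profile: reading the vectors from the right, each
-- step of the max/min increases by 0 or 1.  This yields explicit operations
-- _∨_ and _∧_ whose profiles are the pointwise max/min, so 𝓛ₙ is a lattice.
-- For the recursion: appending a common last entry ε shifts every count of
-- the profile by the same amount, which commutes with max/min; this gives
-- the case s_n = t_n.  In the mixed case s_n = −1, t_n = 1, the join s ∨ t
-- ends in +1 and lies above s, hence above w = m⁺ₙ(s) ≥ s; from
-- s ≤ w ≤ s ∨ t one gets s ∨ t = w ∨ t, and w, t share their last entry.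
-- Dually s ∧ t = s ∧ m⁻ₙ(t).

open import Defs
open import Data.Bool using (Bool; true; false)
open import Data.Nat using (ℕ; suc; _≤_)
open import Data.Vec using (Vec; last; _∷ʳ_)
open import Data.Product using (Σ; _×_)
open import Relation.Binary.PropositionalEquality using (_≡_)
open import Relation.Binary.Lattice.Structures using (IsLattice)

open import Data.Nat using (zero; _+_; _*_; _∸_; _⊔_; _⊓_; _<_; _≤ᵇ_; _<ᵇ_; s≤s; s≤s⁻¹; z<s)
import Data.Nat.Properties as ℕ
open import Data.Integer as ℤ using (+_)
import Data.Integer.Properties as ℤ
open import Data.Integer.Tactic.RingSolver using (solve-∀)
open import Data.Fin using (Fin; toℕ; fromℕ<)
open import Data.Fin.Properties using (toℕ<n; toℕ-fromℕ<)
open import Data.Vec using ([]; _∷_; toList; initLast)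
open import Data.Product using (_,_; proj₁; proj₂)
open import Relation.Binary.PropositionalEquality
  using (refl; sym; cong; cong₂; subst; subst₂; isEquivalence; module ≡-Reasoning)
open import Relation.Binary.Structures using (IsPartialOrder)
open import Relation.Nullary.Reflects using (ofʸ; ofⁿ)
open ≡-Reasoning

-- Suffix counts

[_] : Bool → ℕ
[ true ]  = 1
[ false ] = 0

[]-injective : ∀ {a b} → [ a ] ≡ [ b ] → a ≡ b
[]-injective {true}  {true}  _ = refl
[]-injective {false} {false} _ = refl

1≤[b]⇒b≡true : ∀ {b} → 1 ≤ [ b ] → b ≡ true
1≤[b]⇒b≡true {true} _ = refl

[b]≤0⇒b≡false : ∀ {b} → [ b ] ≤ 0 → b ≡ false
[b]≤0⇒b≡false {false} _ = refl

count : ∀ {n} → Vec Bool n → ℕ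
count []      = 0
count (x ∷ s) = [ x ] + count s

suffixCount : ∀ {n} → ℕ → Vec Bool n → ℕ
suffixCount zero    s       = count s
suffixCount (suc k) []      = 0
suffixCount (suc k) (x ∷ s) = suffixCount k s

sum-count : ∀ {n} (s : Vec Bool n) → sumL (toList s) ℤ.+ + n ≡ + (2 * count s)
sum-count [] = refl
sum-count {suc n} (x ∷ s) = begin
  (val x ℤ.+ sumL (toList s)) ℤ.+ (+ 1 ℤ.+ + n)  ≡⟨ regroup (val x) (sumL (toList s)) (+ n) ⟩
  (val x ℤ.+ + 1) ℤ.+ (sumL (toList s) ℤ.+ + n)  ≡⟨ cong₂ ℤ._+_ (val+1 x) (sum-count s) ⟩
  + (2 * [ x ] + 2 * count s)                    ≡⟨ cong +_ (sym (ℕ.*-distribˡ-+ 2 [ x ] (count s))) ⟩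
  + (2 * count (x ∷ s))                          ∎
  where
  regroup : ∀ a b c → (a ℤ.+ b) ℤ.+ (+ 1 ℤ.+ c) ≡ (a ℤ.+ + 1) ℤ.+ (b ℤ.+ c)
  regroup = solve-∀
  val+1 : ∀ b → val b ℤ.+ + 1 ≡ + (2 * [ b ])
  val+1 true  = refl
  val+1 false = refl

suffixSum-count : ∀ {n} (k : Fin n) (s : Vec Bool n) →
                  suffixSum k s ℤ.+ + (n ∸ toℕ k) ≡ + (2 * suffixCount (toℕ k) s)
suffixSum-count Fin.zero    s       = sum-count s
suffixSum-count (Fin.suc k) (x ∷ s) = suffixSum-count k s

shifted-≤⇒ : ∀ {x y c a b} → x ℤ.+ c ≡ + (2 * a) → y ℤ.+ c ≡ + (2 * b) → x ℤ.≤ y → a ≤ b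
shifted-≤⇒ {c = c} ex ey x≤y =
  ℕ.*-cancelˡ-≤ 2 (ℤ.drop‿+≤+ (subst₂ ℤ._≤_ ex ey (ℤ.+-monoˡ-≤ c x≤y)))

shifted-≤⇐ : ∀ {x y c a b} → x ℤ.+ c ≡ + (2 * a) → y ℤ.+ c ≡ + (2 * b) → a ≤ b → x ℤ.≤ y
shifted-≤⇐ {x} {y} {c} ex ey a≤b =
  subst₂ ℤ._≤_ (unshift x c) (unshift y c)
    (ℤ.+-monoˡ-≤ (ℤ.- c) (subst₂ ℤ._≤_ (sym ex) (sym ey) (ℤ.+≤+ (ℕ.*-monoʳ-≤ 2 a≤b))))
  where
  unshift : ∀ z c → (z ℤ.+ c) ℤ.+ ℤ.- c ≡ z
  unshift = solve-∀

infix 4 _≼_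

_≼_ : ∀ {n} → Vec Bool n → Vec Bool n → Set
_≼_ {n} s t = ∀ k → k < n → suffixCount k s ≤ suffixCount k t

≤ₙ⇒≼ : ∀ {n} {s t : Vec Bool n} → s ≤ₙ t → s ≼ t
≤ₙ⇒≼ {s = s} {t} s≤t k k<n =
  subst (λ i → suffixCount i s ≤ suffixCount i t) (toℕ-fromℕ< k<n)
    (shifted-≤⇒ (suffixSum-count i s) (suffixSum-count i t) (s≤t i))
  where i = fromℕ< k<n

≼⇒≤ₙ : ∀ {n} {s t : Vec Bool n} → s ≼ t → s ≤ₙ t
≼⇒≤ₙ {s = s} {t} s≼t k =
  shifted-≤⇐ (suffixSum-count k s) (suffixSum-count k t) (s≼t (toℕ k) (toℕ<n k))

≼-antisym : ∀ {n} {s t : Vec Bool n} → s ≼ t → t ≼ s → s ≡ t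
≼-antisym {s = []}    {[]}    _ _ = refl
≼-antisym {s = x ∷ s} {y ∷ t} p q with ≼-antisym (λ k k<n → p (suc k) (s≤s k<n))
                                                   (λ k k<n → q (suc k) (s≤s k<n))
... | refl = cong (_∷ s) ([]-injective
               (ℕ.+-cancelʳ-≡ (count s) [ x ] [ y ] (ℕ.≤-antisym (p 0 z<s) (q 0 z<s))))

profile-≡ : ∀ {n} {s t : Vec Bool n} →
            (∀ k → k < n → suffixCount k s ≡ suffixCount k t) → s ≡ t
profile-≡ e = ≼-antisym (λ k k<n → ℕ.≤-reflexive (e k k<n))
                        (λ k k<n → ℕ.≤-reflexive (sym (e k k<n)))

≤ₙ-isPartialOrder : ∀ n → IsPartialOrder _≡_ (_≤ₙ_ {n})
≤ₙ-isPartialOrder n = record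
  { isPreorder = record
    { isEquivalence = isEquivalence
    ; reflexive     = λ { refl k → ℤ.≤-refl }
    ; trans         = λ p q k → ℤ.≤-trans (p k) (q k)
    }
  ; antisym = λ p q → ≼-antisym (≤ₙ⇒≼ p) (≤ₙ⇒≼ q)
  }

-- Join and meet

-- The first entry of s ∨ t, given the entries x, y and the counts a, b of
-- the tails: chosen so that [ x∨y ] + max(a,b) = max([ x ] + a, [ y ] + b).
joinBit : Bool → Bool → ℕ → ℕ → Bool
joinBit true  true  _ _ = true
joinBit false false _ _ = false
joinBit true  false a b = b ≤ᵇ a
joinBit false true  a b = a ≤ᵇ b

joinBit-count : ∀ x y a b → [ joinBit x y a b ] + (a ⊔ b) ≡ ([ x ] + a) ⊔ ([ y ] + b)
joinBit-count true  true  a b = refl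
joinBit-count false false a b = refl
joinBit-count true  false a b with b ≤ᵇ a | ℕ.≤ᵇ-reflects-≤ b a
... | true  | ofʸ b≤a = begin
  1 + (a ⊔ b)  ≡⟨ cong suc (ℕ.m≥n⇒m⊔n≡m b≤a) ⟩
  1 + a        ≡⟨ ℕ.m≥n⇒m⊔n≡m (ℕ.m≤n⇒m≤1+n b≤a) ⟨
  (1 + a) ⊔ b  ∎
... | false | ofⁿ b≰a = begin
  a ⊔ b        ≡⟨ ℕ.m≤n⇒m⊔n≡n (ℕ.<⇒≤ a<b) ⟩
  b            ≡⟨ ℕ.m≤n⇒m⊔n≡n a<b ⟨
  (1 + a) ⊔ b  ∎
  where a<b = ℕ.≰⇒> b≰a
joinBit-count false true  a b = begin
  [ joinBit true false b a ] + (a ⊔ b)  ≡⟨ cong (λ m → [ joinBit true false b a ] + m) (ℕ.⊔-comm a b) ⟩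
  [ joinBit true false b a ] + (b ⊔ a)  ≡⟨ joinBit-count true false b a ⟩
  (1 + b) ⊔ a                           ≡⟨ ℕ.⊔-comm (1 + b) a ⟩
  a ⊔ (1 + b)                           ∎

-- Dually, the first entry of s ∧ t satisfies
-- [ x∧y ] + min(a,b) = min([ x ] + a, [ y ] + b).
meetBit : Bool → Bool → ℕ → ℕ → Bool
meetBit true  true  _ _ = true
meetBit false false _ _ = false
meetBit true  false a b = a <ᵇ b
meetBit false true  a b = b <ᵇ a

meetBit-count : ∀ x y a b → [ meetBit x y a b ] + (a ⊓ b) ≡ ([ x ] + a) ⊓ ([ y ] + b)
meetBit-count true  true  a b = refl
meetBit-count false false a b = refl
meetBit-count true  false a b with a <ᵇ b | ℕ.<ᵇ-reflects-< a b
... | true  | ofʸ a<b = begin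
  1 + (a ⊓ b)  ≡⟨ cong suc (ℕ.m≤n⇒m⊓n≡m (ℕ.<⇒≤ a<b)) ⟩
  1 + a        ≡⟨ ℕ.m≤n⇒m⊓n≡m a<b ⟨
  (1 + a) ⊓ b  ∎
... | false | ofⁿ a≮b = begin
  a ⊓ b        ≡⟨ ℕ.m≥n⇒m⊓n≡n b≤a ⟩
  b            ≡⟨ ℕ.m≥n⇒m⊓n≡n (ℕ.m≤n⇒m≤1+n b≤a) ⟨
  (1 + a) ⊓ b  ∎
  where b≤a = ℕ.≮⇒≥ a≮b
meetBit-count false true  a b = begin
  [ meetBit true false b a ] + (a ⊓ b)  ≡⟨ cong (λ m → [ meetBit true false b a ] + m) (ℕ.⊓-comm a b) ⟩
  [ meetBit true false b a ] + (b ⊓ a)  ≡⟨ meetBit-count true false b a ⟩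
  (1 + b) ⊓ a                           ≡⟨ ℕ.⊓-comm (1 + b) a ⟩
  a ⊓ (1 + b)                           ∎

-- The join and meet, built from the right so that the profile of the
-- result is the pointwise max (min) of the profiles.
infixr 6 _∨_
infixr 7 _∧_

_∨_ : ∀ {n} → Vec Bool n → Vec Bool n → Vec Bool n
[]      ∨ []      = []
(x ∷ s) ∨ (y ∷ t) = joinBit x y (count s) (count t) ∷ (s ∨ t)

_∧_ : ∀ {n} → Vec Bool n → Vec Bool n → Vec Bool n
[]      ∧ []      = []
(x ∷ s) ∧ (y ∷ t) = meetBit x y (count s) (count t) ∷ (s ∧ t)

suffixCount-∨ : ∀ {n} k (s t : Vec Bool n) →
                suffixCount k (s ∨ t) ≡ suffixCount k s ⊔ suffixCount k t
suffixCount-∨ zero    []      []      = refl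
suffixCount-∨ (suc k) []      []      = refl
suffixCount-∨ zero    (x ∷ s) (y ∷ t) = begin
  [ joinBit x y (count s) (count t) ] + count (s ∨ t)
    ≡⟨ cong (λ m → [ joinBit x y (count s) (count t) ] + m) (suffixCount-∨ zero s t) ⟩
  [ joinBit x y (count s) (count t) ] + (count s ⊔ count t)
    ≡⟨ joinBit-count x y (count s) (count t) ⟩
  count (x ∷ s) ⊔ count (y ∷ t) ∎
suffixCount-∨ (suc k) (x ∷ s) (y ∷ t) = suffixCount-∨ k s t

suffixCount-∧ : ∀ {n} k (s t : Vec Bool n) →
                suffixCount k (s ∧ t) ≡ suffixCount k s ⊓ suffixCount k t
suffixCount-∧ zero    []      []      = refl
suffixCount-∧ (suc k) []      []      = refl
suffixCount-∧ zero    (x ∷ s) (y ∷ t) = begin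
  [ meetBit x y (count s) (count t) ] + count (s ∧ t)
    ≡⟨ cong (λ m → [ meetBit x y (count s) (count t) ] + m) (suffixCount-∧ zero s t) ⟩
  [ meetBit x y (count s) (count t) ] + (count s ⊓ count t)
    ≡⟨ meetBit-count x y (count s) (count t) ⟩
  count (x ∷ s) ⊓ count (y ∷ t) ∎
suffixCount-∧ (suc k) (x ∷ s) (y ∷ t) = suffixCount-∧ k s t

∨-upperˡ : ∀ {n} (s t : Vec Bool n) → s ≼ s ∨ t
∨-upperˡ s t k _ = ℕ.≤-trans (ℕ.m≤m⊔n _ _) (ℕ.≤-reflexive (sym (suffixCount-∨ k s t)))

∨-upperʳ : ∀ {n} (s t : Vec Bool n) → t ≼ s ∨ t
∨-upperʳ s t k _ = ℕ.≤-trans (ℕ.m≤n⊔m _ _) (ℕ.≤-reflexive (sym (suffixCount-∨ k s t)))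

∨-least : ∀ {n} {s t u : Vec Bool n} → s ≼ u → t ≼ u → s ∨ t ≼ u
∨-least {s = s} {t} p q k k<n =
  ℕ.≤-trans (ℕ.≤-reflexive (suffixCount-∨ k s t)) (ℕ.⊔-lub (p k k<n) (q k k<n))

∧-lowerˡ : ∀ {n} (s t : Vec Bool n) → s ∧ t ≼ s
∧-lowerˡ s t k _ = ℕ.≤-trans (ℕ.≤-reflexive (suffixCount-∧ k s t)) (ℕ.m⊓n≤m _ _)

∧-lowerʳ : ∀ {n} (s t : Vec Bool n) → s ∧ t ≼ t
∧-lowerʳ s t k _ = ℕ.≤-trans (ℕ.≤-reflexive (suffixCount-∧ k s t)) (ℕ.m⊓n≤n _ _)

∧-greatest : ∀ {n} {s t u : Vec Bool n} → u ≼ s → u ≼ t → u ≼ s ∧ t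
∧-greatest {s = s} {t} p q k k<n =
  ℕ.≤-trans (ℕ.⊓-glb (p k k<n) (q k k<n)) (ℕ.≤-reflexive (sym (suffixCount-∧ k s t)))

≤ₙ-isLattice : ∀ n → IsLattice _≡_ (_≤ₙ_ {n}) _∨_ _∧_
≤ₙ-isLattice n = record
  { isPartialOrder = ≤ₙ-isPartialOrder n
  ; supremum = λ s t → ≼⇒≤ₙ (∨-upperˡ s t) , ≼⇒≤ₙ (∨-upperʳ s t)
                     , λ u p q → ≼⇒≤ₙ (∨-least (≤ₙ⇒≼ p) (≤ₙ⇒≼ q))
  ; infimum  = λ s t → ≼⇒≤ₙ (∧-lowerˡ s t) , ≼⇒≤ₙ (∧-lowerʳ s t)
                     , λ u p q → ≼⇒≤ₙ (∧-greatest (≤ₙ⇒≼ p) (≤ₙ⇒≼ q))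
  }

count-∷ʳ : ∀ {n} (s : Vec Bool n) b → count (s ∷ʳ b) ≡ count s + [ b ]
count-∷ʳ []      b = ℕ.+-identityʳ [ b ]
count-∷ʳ (x ∷ s) b = begin
  [ x ] + count (s ∷ʳ b)   ≡⟨ cong (λ m → [ x ] + m) (count-∷ʳ s b) ⟩
  [ x ] + (count s + [ b ]) ≡⟨ ℕ.+-assoc [ x ] (count s) [ b ] ⟨
  [ x ] + count s + [ b ]   ∎

suffixCount-∷ʳ : ∀ {n} k (s : Vec Bool n) b → k ≤ n →
                 suffixCount k (s ∷ʳ b) ≡ suffixCount k s + [ b ]
suffixCount-∷ʳ zero    s       b _         = count-∷ʳ s b
suffixCount-∷ʳ (suc k) (x ∷ s) b (s≤s k≤n) = suffixCount-∷ʳ k s b k≤n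

suffixCount-end : ∀ {n} (s : Vec Bool n) → suffixCount n s ≡ 0
suffixCount-end []      = refl
suffixCount-end (x ∷ s) = suffixCount-end s

split-last : ∀ {n} (s : Vec Bool (suc n)) → s ≡ π s ∷ʳ last s
split-last s = proj₂ (proj₂ (initLast s))

suffixCount-last : ∀ {n} (s : Vec Bool (suc n)) → suffixCount n s ≡ [ last s ]
suffixCount-last {n} s = begin
  suffixCount n s                     ≡⟨ cong (suffixCount n) (split-last s) ⟩
  suffixCount n (π s ∷ʳ last s)       ≡⟨ suffixCount-∷ʳ n (π s) (last s) ℕ.≤-refl ⟩
  suffixCount n (π s) + [ last s ]    ≡⟨ cong (_+ [ last s ]) (suffixCount-end (π s)) ⟩
  [ last s ]                          ∎

last-mono : ∀ {n} {s t : Vec Bool (suc n)} → s ≼ t → [ last s ] ≤ [ last t ]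
last-mono {n} {s} {t} s≼t =
  subst₂ _≤_ (suffixCount-last s) (suffixCount-last t) (s≼t n (ℕ.n<1+n n))

last-true-up : ∀ {n} {s t : Vec Bool (suc n)} → s ≼ t → last s ≡ true → last t ≡ true
last-true-up {t = t} s≼t ls =
  1≤[b]⇒b≡true (subst (λ b → [ b ] ≤ [ last t ]) ls (last-mono s≼t))

last-false-down : ∀ {n} {s t : Vec Bool (suc n)} → s ≼ t → last t ≡ false → last s ≡ false
last-false-down {s = s} s≼t lt =
  [b]≤0⇒b≡false (subst (λ b → [ last s ] ≤ [ b ]) lt (last-mono s≼t))

-- An operation acting on suffix counts through a translation-equivariant
-- f (as _∨_ through max and _∧_ through min) commutes with appending a
-- common last entry; this is the case s_n = t_n of the recursion.
pointwise-same-last :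
  (op : ∀ {n} → Vec Bool n → Vec Bool n → Vec Bool n) (f : ℕ → ℕ → ℕ) →
  (∀ {n} k (s t : Vec Bool n) → suffixCount k (op s t) ≡ f (suffixCount k s) (suffixCount k t)) →
  (∀ c a b → f a b + c ≡ f (a + c) (b + c)) →
  ∀ {n} (s t : Vec Bool (suc n)) b → last s ≡ b → last t ≡ b → op s t ≡ op (π s) (π t) ∷ʳ b
pointwise-same-last op f op-count f-equivariant s t b ls lt = begin
  op s t                          ≡⟨ cong₂ op (split s ls) (split t lt) ⟩
  op (π s ∷ʳ b) (π t ∷ʳ b)        ≡⟨ profile-≡ (λ k k<1+n → append-count k (s≤s⁻¹ k<1+n)) ⟩
  op (π s) (π t) ∷ʳ b             ∎
  where
  split : ∀ {n} (u : Vec Bool (suc n)) → last u ≡ b → u ≡ π u ∷ʳ b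
  split u lu = subst (λ c → u ≡ π u ∷ʳ c) lu (split-last u)

  append-count : ∀ k → k ≤ _ → suffixCount k (op (π s ∷ʳ b) (π t ∷ʳ b))
                             ≡ suffixCount k (op (π s) (π t) ∷ʳ b)
  append-count k k≤n = begin
    suffixCount k (op (π s ∷ʳ b) (π t ∷ʳ b))
      ≡⟨ op-count k (π s ∷ʳ b) (π t ∷ʳ b) ⟩
    f (suffixCount k (π s ∷ʳ b)) (suffixCount k (π t ∷ʳ b))
      ≡⟨ cong₂ f (suffixCount-∷ʳ k (π s) b k≤n) (suffixCount-∷ʳ k (π t) b k≤n) ⟩
    f (suffixCount k (π s) + [ b ]) (suffixCount k (π t) + [ b ])
      ≡⟨ f-equivariant [ b ] _ _ ⟨
    f (suffixCount k (π s)) (suffixCount k (π t)) + [ b ]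
      ≡⟨ cong (_+ [ b ]) (op-count k (π s) (π t)) ⟨
    suffixCount k (op (π s) (π t)) + [ b ]
      ≡⟨ suffixCount-∷ʳ k (op (π s) (π t)) b k≤n ⟨
    suffixCount k (op (π s) (π t) ∷ʳ b) ∎

-- The mixed case s_n = −1, t_n = +1

⊔-between : ∀ {a b c} → a ≤ c → c ≤ a ⊔ b → a ⊔ b ≡ c ⊔ b
⊔-between {a} {b} a≤c c≤a⊔b =
  ℕ.≤-antisym (ℕ.⊔-mono-≤ a≤c ℕ.≤-refl) (ℕ.⊔-lub c≤a⊔b (ℕ.m≤n⊔m a b))

⊓-between : ∀ {a b c} → a ⊓ b ≤ c → c ≤ b → a ⊓ b ≡ a ⊓ c
⊓-between {a} {b} a⊓b≤c c≤b =
  ℕ.≤-antisym (ℕ.⊓-glb (ℕ.m⊓n≤m a b) a⊓b≤c) (ℕ.⊓-mono-≤ ℕ.≤-refl c≤b)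

∨-between : ∀ {n} {s t w : Vec Bool n} → s ≼ w → w ≼ s ∨ t → s ∨ t ≡ w ∨ t
∨-between {s = s} {t} {w} s≼w w≼s∨t = profile-≡ λ k k<n → begin
  suffixCount k (s ∨ t)                   ≡⟨ suffixCount-∨ k s t ⟩
  suffixCount k s ⊔ suffixCount k t       ≡⟨ ⊔-between (s≼w k k<n)
                                               (subst (suffixCount k w ≤_) (suffixCount-∨ k s t) (w≼s∨t k k<n)) ⟩
  suffixCount k w ⊔ suffixCount k t       ≡⟨ suffixCount-∨ k w t ⟨
  suffixCount k (w ∨ t)                   ∎

∧-between : ∀ {n} {s t w : Vec Bool n} → s ∧ t ≼ w → w ≼ t → s ∧ t ≡ s ∧ w
∧-between {s = s} {t} {w} s∧t≼w w≼t = profile-≡ λ k k<n → begin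
  suffixCount k (s ∧ t)                   ≡⟨ suffixCount-∧ k s t ⟩
  suffixCount k s ⊓ suffixCount k t       ≡⟨ ⊓-between
                                               (subst (_≤ suffixCount k w) (suffixCount-∧ k s t) (s∧t≼w k k<n))
                                               (w≼t k k<n) ⟩
  suffixCount k s ⊓ suffixCount k w       ≡⟨ suffixCount-∧ k s w ⟨
  suffixCount k (s ∧ w)                   ∎

-- If t ends in +1 then s ∨ t ends in +1 and lies above s, hence above
-- m⁺ₙ(s); so s ∨ t = m⁺ₙ(s) ∨ t.
∨-via-m⁺ : ∀ {n} (s t w : Vec Bool (suc n)) → last t ≡ true → IsMPlus s w → s ∨ t ≡ w ∨ t
∨-via-m⁺ s t w lt ((_ , s≤w) , least) = ∨-between (≤ₙ⇒≼ s≤w) (≤ₙ⇒≼ w≤s∨t)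
  where
  w≤s∨t : w ≤ₙ (s ∨ t)
  w≤s∨t = least (s ∨ t) (last-true-up (∨-upperʳ s t) lt) (≼⇒≤ₙ (∨-upperˡ s t))

-- If s ends in −1 then s ∧ t ends in −1 and lies below t, hence below
-- m⁻ₙ(t); so s ∧ t = s ∧ m⁻ₙ(t).
∧-via-m⁻ : ∀ {n} (s t w : Vec Bool (suc n)) → last s ≡ false → IsMMinus t w → s ∧ t ≡ s ∧ w
∧-via-m⁻ s t w ls ((_ , w≤t) , greatest) = ∧-between (≤ₙ⇒≼ s∧t≤w) (≤ₙ⇒≼ w≤t)
  where
  s∧t≤w : (s ∧ t) ≤ₙ w
  s∧t≤w = greatest (s ∧ t) (last-false-down (∧-lowerˡ s t) ls) (≼⇒≤ₙ (∧-lowerʳ s t))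

∨-same-last : ∀ {n} (s t : Vec Bool (suc n)) b → last s ≡ b → last t ≡ b →
              s ∨ t ≡ (π s ∨ π t) ∷ʳ b
∨-same-last = pointwise-same-last _∨_ _⊔_ suffixCount-∨ ℕ.+-distribʳ-⊔

∧-same-last : ∀ {n} (s t : Vec Bool (suc n)) b → last s ≡ b → last t ≡ b →
              s ∧ t ≡ (π s ∧ π t) ∷ʳ b
∧-same-last = pointwise-same-last _∧_ _⊓_ suffixCount-∧ ℕ.+-distribʳ-⊓

proposition3p16 :
    Σ (∀ n → Vec Bool n → Vec Bool n → Vec Bool n) λ join →
    Σ (∀ n → Vec Bool n → Vec Bool n → Vec Bool n) λ meet →
      (∀ n → 1 ≤ n → IsLattice _≡_ (_≤ₙ_ {n}) (join n) (meet n))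
      × (∀ m (s t : Vec Bool (suc (suc m))) (ε : Bool) → last s ≡ ε → last t ≡ ε →
           join (suc (suc m)) s t ≡ join (suc m) (π s) (π t) ∷ʳ ε)
      × (∀ m (s t : Vec Bool (suc (suc m))) → last s ≡ false → last t ≡ true →
           ∀ w → IsMPlus s w →
           join (suc (suc m)) s t ≡ join (suc m) (π w) (π t) ∷ʳ true)
      × (∀ m (s t : Vec Bool (suc (suc m))) (ε : Bool) → last s ≡ ε → last t ≡ ε →
           meet (suc (suc m)) s t ≡ meet (suc m) (π s) (π t) ∷ʳ ε)
      × (∀ m (s t : Vec Bool (suc (suc m))) → last s ≡ false → last t ≡ true →
           ∀ w → IsMMinus t w →
           meet (suc (suc m)) s t ≡ meet (suc m) (π s) (π w) ∷ʳ false)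
proposition3p16 =
    (λ _ → _∨_) , (λ _ → _∧_)
  , (λ n _ → ≤ₙ-isLattice n)
  , (λ _ s t ε → ∨-same-last s t ε)
  , (λ _ s t _ lt w m⁺ → begin
       s ∨ t                 ≡⟨ ∨-via-m⁺ s t w lt m⁺ ⟩
       w ∨ t                 ≡⟨ ∨-same-last w t true (proj₁ (proj₁ m⁺)) lt ⟩
       (π w ∨ π t) ∷ʳ true   ∎)
  , (λ _ s t ε → ∧-same-last s t ε)
  , (λ _ s t ls _ w m⁻ → begin
       s ∧ t                 ≡⟨ ∧-via-m⁻ s t w ls m⁻ ⟩
       s ∧ w                 ≡⟨ ∧-same-last s w false ls (proj₁ (proj₁ m⁻)) ⟩
       (π s ∧ π w) ∷ʳ false  ∎)
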